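{- Let $\Gamma$ be a graph, let $G \leq \mathrm{Aut}(\Gamma)$, and let $\alpha$ be a $G$-consistent walk. Suppose that $\alpha$ has Property (R) with respect to $G$ and that $G_\alpha$ fixes every element of $\mathrm{Succ}_G(\alpha)$. Then $G_\alpha = 1$.
   Context: All graphs are finite and simple with at least three vertices. Automorphisms act on the right, $x \mapsto x^g$, and act on tuples of vertices coordinatewise; for a tuple $\beta$ of vertices, $G_\beta$ denotes the subgroup of $G$ fixing every entry of $\beta$. A walk of length $n \geq 1$ is a tuple $(v_0, \ldots, v_n)$ of vertices in which any two consecutive vertices are adjacent. For $G \leq \mathrm{Aut}(\Gamma)$, a walk $\alpha = (v_0, \ldots, v_n)$ is $G$-consistent if there exists $g \in G$ (a shunt of $\alpha$) with $v_i^g = v_{i+1}$ for all $i \in \{0, \ldots, n-1\}$; $\mathrm{Sh}_G(\alpha)$ is the set of such shunts. For a $G$-consistent walk $\alpha = (v_0, \ldots, v_n)$, a walk $(v_1, \ldots, v_n, v_{n+1})$ is a $G$-successor of $\alpha$ if there is $g \in \mathrm{Sh}_G(\alpha)$ with $v_n^g = v_{n+1}$; $\mathrm{Succ}_G(\alpha)$ is the set of $G$-successors of $\alpha$. A $G$-consistent walk $\alpha$ has Property (R) with respect to $G$ if for every vertex $v$ there exists a sequence of walks $\beta_0 = \alpha, \beta_1, \ldots, \beta_m$ with $\beta_{i+1} \in \mathrm{Succ}_G(\beta_i)$ for all $i$ and the last vertex of $\beta_m$ equal to $v$. -}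

module Defs where

open import Level using (Level; _⊔_) renaming (suc to lsuc; zero to 0ℓ)
open import Data.Nat using (ℕ; suc; _≤_)
open import Data.Fin using (Fin; inject₁; fromℕ) renaming (suc to fsuc)
open import Data.Fin.Permutation using (Permutation′; _⟨$⟩ʳ_; _∘ₚ_; flip; id)
open import Data.Product using (Σ; _×_; _,_)
open import Relation.Binary.PropositionalEquality using (_≡_)
open import Relation.Nullary using (¬_)

record Graph : Set₁ where
  field
    n      : ℕ
    3≤n    : 3 ≤ n
    Adj    : Fin n → Fin n → Set
    sym    : ∀ {x y} → Adj x y → Adj y x
    irrefl : ∀ {x} → ¬ Adj x x

module _ (Γ : Graph) where
  open Graph Γ

  Vertex : Set
  Vertex = Fin n

  Perm : Set
  Perm = Permutation′ n

  _^_ : Vertex → Perm → Vertex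
  x ^ g = g ⟨$⟩ʳ x

  IsAutomorphism : Perm → Set
  IsAutomorphism g = ∀ x y → (Adj x y → Adj (x ^ g) (y ^ g)) × (Adj (x ^ g) (y ^ g) → Adj x y)

  -- A subgroup G ≤ Aut(Γ), given by a membership predicate.
  -- (g ∘ₚ h) acts as x ↦ (x^g)^h.
  record Subgroup : Set₁ where
    field
      Mem     : Perm → Set
      ⊆Aut    : ∀ {g} → Mem g → IsAutomorphism g
      id∈     : Mem id
      ∘∈      : ∀ {g h} → Mem g → Mem h → Mem (g ∘ₚ h)
      inv∈    : ∀ {g} → Mem g → Mem (flip g)

  -- A walk of length k ≥ 1 is a tuple (v_0, …, v_k), encoded as a function Fin (suc k) → Vertex.
  Tuple : ℕ → Set
  Tuple k = Fin (suc k) → Vertex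

  IsWalk : ∀ {k} → Tuple k → Set
  IsWalk {k} α = 1 ≤ k × (∀ (i : Fin k) → Adj (α (inject₁ i)) (α (fsuc i)))

  lastV : ∀ {k} → Tuple k → Vertex
  lastV {k} α = α (fromℕ k)

  Fixes : ∀ {k} → Perm → Tuple k → Set
  Fixes {k} g α = ∀ (i : Fin (suc k)) → α i ^ g ≡ α i

  module _ (G : Subgroup) where
    open Subgroup G

    IsShunt : ∀ {k} → Tuple k → Perm → Set
    IsShunt {k} α g = Mem g × (∀ (i : Fin k) → α (inject₁ i) ^ g ≡ α (fsuc i))

    IsConsistent : ∀ {k} → Tuple k → Set
    IsConsistent α = IsWalk α × Σ Perm (IsShunt α)

    IsSucc : ∀ {k} → Tuple k → Tuple k → Set
    IsSucc {k} α β =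
      IsConsistent α × IsWalk β ×
      (∀ (i : Fin k) → β (inject₁ i) ≡ α (fsuc i)) ×
      Σ Perm (λ g → IsShunt α g × (lastV α ^ g ≡ lastV β))

    data SuccSeq {k} : Tuple k → Vertex → Set where
      done : ∀ {α v} → lastV α ≡ v → SuccSeq α v
      step : ∀ {α β v} → IsSucc α β → SuccSeq β v → SuccSeq α v

    PropertyR : ∀ {k} → Tuple k → Set
    PropertyR α = IsConsistent α × (∀ v → SuccSeq α v)

-- A successor β of α is its image under a shunt g ∈ G, and conjugation by g
-- maps G_α onto G_β and Succ(α) onto Succ(β). So the hypothesis "G_α fixes
-- Succ(α)" is inherited by every successor, and G_α ≤ G_β. Following the
-- chains of successors given by Property (R), G_α fixes every vertex.
{-# OPTIONS --safe #-}
module Submission where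

open import Defs
open import Data.Nat using (ℕ)
open import Data.Fin using (Fin; inject₁) renaming (suc to fsuc)
open import Data.Fin.Relation.Unary.Top using (view; ‵fromℕ; ‵inject₁)
open import Data.Fin.Permutation
  using (Permutation′; _⟨$⟩ʳ_; _∘ₚ_; flip; inverseˡ; inverseʳ)
open import Data.Product using (Σ; _×_; _,_; proj₁)
open import Function using (_∘_; _⇔_; mk⇔; Equivalence)
open import Relation.Binary.PropositionalEquality
  using (_≡_; _≗_; refl; sym; trans; cong; subst; subst₂; module ≡-Reasoning)

open Equivalence using (to; from)

module _ {n : ℕ} where

  conj : Permutation′ n → Permutation′ n → Permutation′ n
  conj g f = (g ∘ₚ f) ∘ₚ flip g

  conj-fixes⇔ : ∀ g f x → conj g f ⟨$⟩ʳ x ≡ x ⇔ f ⟨$⟩ʳ (g ⟨$⟩ʳ x) ≡ g ⟨$⟩ʳ x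
  conj-fixes⇔ g f x = mk⇔
    (λ fixed → trans (sym (inverseʳ g)) (cong (g ⟨$⟩ʳ_) fixed))
    (λ fixed → trans (cong (flip g ⟨$⟩ʳ_) fixed) (inverseˡ g))

  conj-flip-translate : ∀ g h {x y} → y ≡ g ⟨$⟩ʳ x →
                        conj (flip g) h ⟨$⟩ʳ y ≡ g ⟨$⟩ʳ (h ⟨$⟩ʳ x)
  conj-flip-translate g h {x} refl = cong (λ z → g ⟨$⟩ʳ (h ⟨$⟩ʳ z)) (inverseˡ g)

  translate-flip : ∀ {A : Set} g {α β : A → Fin n} →
                   β ≗ (g ⟨$⟩ʳ_) ∘ α → α ≗ (flip g ⟨$⟩ʳ_) ∘ β
  translate-flip g β≗gα j = trans (sym (inverseˡ g)) (cong (flip g ⟨$⟩ʳ_) (sym (β≗gα j)))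

module _ (Γ : Graph) where

  Fixes-conj : ∀ {k} {g f} {α β : Tuple Γ k} → β ≗ (g ⟨$⟩ʳ_) ∘ α →
               Fixes Γ f β ⇔ Fixes Γ (conj g f) α
  Fixes-conj {g = g} {f} {α} β≗gα = mk⇔
    (λ fixβ j → from (conj-fixes⇔ g f (α j)) (subst (fixedBy f) (β≗gα j) (fixβ j)))
    (λ fixα j → subst (fixedBy f) (sym (β≗gα j)) (to (conj-fixes⇔ g f (α j)) (fixα j)))
    where
      fixedBy : Perm Γ → Vertex Γ → Set
      fixedBy f x = f ⟨$⟩ʳ x ≡ x

  IsWalk-translate : ∀ {k g} {α β : Tuple Γ k} → IsAutomorphism Γ g →
                     β ≗ (g ⟨$⟩ʳ_) ∘ α → IsWalk Γ α → IsWalk Γ β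
  IsWalk-translate aut β≗gα (1≤k , adjacent) = 1≤k , λ i →
    subst₂ (Graph.Adj Γ) (sym (β≗gα _)) (sym (β≗gα _)) (proj₁ (aut _ _) (adjacent i))

  module _ (G : Subgroup Γ) where
    open Subgroup G

    conj∈ : ∀ {g f} → Mem g → Mem f → Mem (conj g f)
    conj∈ {g} {f} g∈ f∈ = ∘∈ {g ∘ₚ f} (∘∈ {g} g∈ f∈) (inv∈ {g} g∈)

    IsShunt-translate : ∀ {k g h} {α β : Tuple Γ k} → Mem g → β ≗ (g ⟨$⟩ʳ_) ∘ α →
                        IsShunt Γ G α h → IsShunt Γ G β (conj (flip g) h)
    IsShunt-translate {g = g} {h} {α} {β} g∈ β≗gα (h∈ , shifts) =
      conj∈ (inv∈ g∈) h∈ , λ i → begin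
      conj (flip g) h ⟨$⟩ʳ β (inject₁ i)  ≡⟨ conj-flip-translate g h (β≗gα (inject₁ i)) ⟩
      g ⟨$⟩ʳ (h ⟨$⟩ʳ α (inject₁ i))       ≡⟨ cong (g ⟨$⟩ʳ_) (shifts i) ⟩
      g ⟨$⟩ʳ α (fsuc i)                   ≡⟨ β≗gα (fsuc i) ⟨
      β (fsuc i)                          ∎
      where open ≡-Reasoning

    IsConsistent-translate : ∀ {k g} {α β : Tuple Γ k} → Mem g → β ≗ (g ⟨$⟩ʳ_) ∘ α →
                             IsConsistent Γ G α → IsConsistent Γ G β
    IsConsistent-translate {g = g} g∈ β≗gα (walk , h , shunt) =
      IsWalk-translate {g = g} (⊆Aut g∈) β≗gα walk ,
      conj (flip g) h , IsShunt-translate g∈ β≗gα shunt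

    IsSucc-translate : ∀ {k g} {α β δ : Tuple Γ k} → Mem g → β ≗ (g ⟨$⟩ʳ_) ∘ α →
                       IsSucc Γ G α δ → IsSucc Γ G β ((g ⟨$⟩ʳ_) ∘ δ)
    IsSucc-translate {g = g} {δ = δ} g∈ β≗gα (consistent , walk , δ≗ , h , shunt , last) =
      IsConsistent-translate g∈ β≗gα consistent ,
      IsWalk-translate {g = g} {α = δ} (⊆Aut g∈) (λ _ → refl) walk ,
      (λ i → trans (cong (g ⟨$⟩ʳ_) (δ≗ i)) (sym (β≗gα (fsuc i)))) ,
      conj (flip g) h ,
      IsShunt-translate g∈ β≗gα shunt ,
      trans (conj-flip-translate g h (β≗gα _)) (cong (g ⟨$⟩ʳ_) last)

    IsSucc⇒translate : ∀ {k} {α β : Tuple Γ k} → IsSucc Γ G α β →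
                       Σ (Perm Γ) λ g → Mem g × β ≗ (g ⟨$⟩ʳ_) ∘ α
    IsSucc⇒translate {α = α} {β} (_ , _ , β≗ , g , (g∈ , shifts) , last) = g , g∈ , entry
      where
        entry : β ≗ (g ⟨$⟩ʳ_) ∘ α
        entry j with view j
        ... | ‵fromℕ     = sym last
        ... | ‵inject₁ i = trans (β≗ i) (sym (shifts i))

    StabiliserFixesSuccessors : ∀ {k} → Tuple Γ k → Set
    StabiliserFixesSuccessors α =
      ∀ β → IsSucc Γ G α β → ∀ f → Mem f → Fixes Γ f α → Fixes Γ f β

    StabiliserFixesSuccessors-translate :
      ∀ {k g} {α β : Tuple Γ k} → Mem g → β ≗ (g ⟨$⟩ʳ_) ∘ α →
      StabiliserFixesSuccessors α → StabiliserFixesSuccessors β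
    StabiliserFixesSuccessors-translate {g = g} g∈ β≗gα fixesα δ δ∈ f f∈ fixβ =
      from (Fixes-conj {g = g} {f} δ≗gδ′)
        (fixesα δ′ (IsSucc-translate {δ = δ} (inv∈ g∈) (translate-flip g β≗gα) δ∈)
                (conj g f) (conj∈ g∈ f∈) (to (Fixes-conj {g = g} {f} β≗gα) fixβ))
      where
        δ′ = (flip g ⟨$⟩ʳ_) ∘ δ
        δ≗gδ′ : δ ≗ (g ⟨$⟩ʳ_) ∘ δ′
        δ≗gδ′ = translate-flip (flip g) {α = δ} {β = δ′} (λ _ → refl)

    StabiliserFixesSuccessors-succ : ∀ {k} {α β : Tuple Γ k} →
      StabiliserFixesSuccessors α → IsSucc Γ G α β → StabiliserFixesSuccessors β
    StabiliserFixesSuccessors-succ fixesα α→β with IsSucc⇒translate α→β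
    ... | g , g∈ , β≗gα = StabiliserFixesSuccessors-translate g∈ β≗gα fixesα

    stabiliser-fixes-reachable : ∀ {k} {α : Tuple Γ k} {v f} → SuccSeq Γ G α v →
      StabiliserFixesSuccessors α → Mem f → Fixes Γ f α → f ⟨$⟩ʳ v ≡ v
    stabiliser-fixes-reachable (done refl) _ _ fixα = fixα _
    stabiliser-fixes-reachable (step α→β reach) fixesα f∈ fixα =
      stabiliser-fixes-reachable reach (StabiliserFixesSuccessors-succ fixesα α→β) f∈
        (fixesα _ α→β _ f∈ fixα)

lemma3p8 : (Γ : Graph) (G : Subgroup Γ) {k : ℕ} (α : Tuple Γ k)
    → IsConsistent Γ G α
    → PropertyR Γ G α
    → (∀ β → IsSucc Γ G α β → ∀ g → Subgroup.Mem G g → Fixes Γ g α → Fixes Γ g β)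
    → ∀ g → Subgroup.Mem G g → Fixes Γ g α → ∀ x → _^_ Γ x g ≡ x
lemma3p8 Γ G α _ (_ , reachable) fixesSucc g g∈ fixα x =
  stabiliser-fixes-reachable Γ G (reachable x) fixesSucc g∈ fixα
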